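{- Let $G$ be a connected graph of order $n\ge 7$, diameter $2$ and minimum degree at least $n-3$. If $\eta_p(G)=n-2$, then $G$ is isomorphic to one of $K_{n-3}\vee(K_2+K_1)$, $K_{n-3}\vee\overline{K_3}$, $K_{n-4}\vee C_4$, $K_{n-4}\vee P_4$, $K_{n-4}\vee 2K_2$.
   Context: Graphs are finite, simple, undirected and connected. $+$ is disjoint union, $\vee$ is join, $\overline{K_m}$ the edgeless graph on $m$ vertices, $2K_2$ two disjoint edges. For $v\in V(G)$, $S\subseteq V(G)$: $d(v,S)=\min\{d(v,w):w\in S\}$. For a partition $\Pi=\{S_1,\dots,S_k\}$ of $V(G)$, $r(u|\Pi)=(d(u,S_1),\dots,d(u,S_k))$; $\Pi$ is resolving if $r(u|\Pi)\ne r(v|\Pi)$ for all distinct $u,v$, and dominating if each vertex $v$ has $d(v,S_j)=1$ for some $j$. $\eta_p(G)$ is the minimum cardinality of a partition that is both resolving and dominating. -}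

module Defs where

open import Data.Bool using (Bool; true; false; _∧_; _∨_; not; if_then_else_)
open import Data.Nat using (ℕ; zero; suc; _+_; _∸_; _⊓_; _≤_)
open import Data.Fin using (Fin; zero; suc; splitAt; _≟_)
open import Data.Sum using (_⊎_; inj₁; inj₂)
open import Data.List using (List; foldr; map; allFin)
open import Data.Bool.ListAction using (any)
open import Data.Nat.ListAction using (sum)
open import Data.Product using (Σ; _×_; ∃; ∃-syntax)
open import Relation.Nullary.Decidable using (⌊_⌋)
open import Relation.Binary.PropositionalEquality using (_≡_)
open import Function.Bundles using (_↔_; Inverse)

Adj : ℕ → Set
Adj n = Fin n → Fin n → Bool

IsGraph : ∀ {n} → Adj n → Set
IsGraph {n} G = (∀ (u v : Fin n) → G u v ≡ G v u) × (∀ (u : Fin n) → G u u ≡ false)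

reach : ∀ {n} → Adj n → ℕ → Fin n → Fin n → Bool
reach {n} G zero    u v = ⌊ u ≟ v ⌋
reach {n} G (suc k) u v = reach G k u v ∨ any (λ w → reach G k u w ∧ G w v) (allFin n)

-- Connected: every vertex reachable from every other (walks of length ≤ n suffice).
Connected : ∀ {n} → Adj n → Set
Connected {n} G = ∀ (u v : Fin n) → reach G n u v ≡ true

-- distance: least k with reach G k u v (searching k = 0 .. n; n if unreachable).
distFrom : ∀ {n} → Adj n → Fin n → Fin n → ℕ → ℕ → ℕ
distFrom G u v zero       k = k
distFrom G u v (suc fuel) k = if reach G k u v then k else distFrom G u v fuel (suc k)

dist : ∀ {n} → Adj n → Fin n → Fin n → ℕ
dist {n} G u v = distFrom G u v n 0

HasDiameter : ∀ {n} → Adj n → ℕ → Set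
HasDiameter {n} G d = (∀ (u v : Fin n) → dist G u v ≤ d) × (∃[ u ] ∃[ v ] dist G u v ≡ d)

deg : ∀ {n} → Adj n → Fin n → ℕ
deg {n} G v = sum (map (λ w → if G v w then 1 else 0) (allFin n))

MinDegreeAtLeast : ∀ {n} → Adj n → ℕ → Set
MinDegreeAtLeast {n} G δ = ∀ (v : Fin n) → δ ≤ deg G v

-- A partition {S_0,…,S_{k-1}} of V(G) is given by the class map c : Fin n → Fin k,
-- S_j = { w | c w ≡ j }; all classes nonempty (c surjective).
IsPartition : ∀ {n k} → (Fin n → Fin k) → Set
IsPartition {n} {k} c = ∀ (j : Fin k) → ∃[ u ] c u ≡ j

-- d(v, S_j) = min { d(v,w) : c w ≡ j }   (default value n is an upper bound for dist;
-- only relevant for an empty class, which partitions exclude)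
setDist : ∀ {n k} → Adj n → (Fin n → Fin k) → Fin n → Fin k → ℕ
setDist {n} G c v j =
  foldr (λ w acc → if ⌊ c w ≟ j ⌋ then dist G v w ⊓ acc else acc) n (allFin n)

IsResolving : ∀ {n k} → Adj n → (Fin n → Fin k) → Set
IsResolving {n} {k} G c =
  ∀ (u v : Fin n) → (∀ (j : Fin k) → setDist G c u j ≡ setDist G c v j) → u ≡ v

IsDominating : ∀ {n k} → Adj n → (Fin n → Fin k) → Set
IsDominating {n} {k} G c = ∀ (v : Fin n) → ∃[ j ] setDist G c v j ≡ 1

IsResDomPartition : ∀ {n k} → Adj n → (Fin n → Fin k) → Set
IsResDomPartition G c = IsPartition c × IsResolving G c × IsDominating G c

EtaP≡ : ∀ {n} → Adj n → ℕ → Set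
EtaP≡ {n} G m =
  (Σ (Fin n → Fin m) λ c → IsResDomPartition G c) ×
  (∀ (k : ℕ) (c : Fin n → Fin k) → IsResDomPartition G c → m ≤ k)

_≅_ : ∀ {n m} → Adj n → Adj m → Set
_≅_ {n} {m} G H =
  Σ (Fin n ↔ Fin m) λ f → ∀ (u v : Fin n) → G u v ≡ H (Inverse.to f u) (Inverse.to f v)

complete : (m : ℕ) → Adj m
complete m u v = not ⌊ u ≟ v ⌋

edgeless : (m : ℕ) → Adj m
edgeless m u v = false

_⊕_ : ∀ {a b} → Adj a → Adj b → Adj (a + b)
_⊕_ {a} G H u v with splitAt a u | splitAt a v
... | inj₁ x | inj₁ y = G x y
... | inj₂ x | inj₂ y = H x y
... | inj₁ _ | inj₂ _ = false
... | inj₂ _ | inj₁ _ = false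

_⋁_ : ∀ {a b} → Adj a → Adj b → Adj (a + b)
_⋁_ {a} G H u v with splitAt a u | splitAt a v
... | inj₁ x | inj₁ y = G x y
... | inj₂ x | inj₂ y = H x y
... | inj₁ _ | inj₂ _ = true
... | inj₂ _ | inj₁ _ = true

-- P4 : 0 - 1 - 2 - 3
path4 : Adj 4
path4 zero (suc zero) = true
path4 (suc zero) zero = true
path4 (suc zero) (suc (suc zero)) = true
path4 (suc (suc zero)) (suc zero) = true
path4 (suc (suc zero)) (suc (suc (suc zero))) = true
path4 (suc (suc (suc zero))) (suc (suc zero)) = true
path4 _ _ = false

-- C4 : 0 - 1 - 2 - 3 - 0
cycle4 : Adj 4
cycle4 zero (suc (suc (suc zero))) = true
cycle4 (suc (suc (suc zero))) zero = true
cycle4 u v = path4 u v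

twoK2 : Adj 4
twoK2 = complete 2 ⊕ complete 2

-- Since δ(G) ≥ n − 3, every vertex has at most two non-neighbours, so the complement H of G is a disjoint
-- union of paths and cycles; it has an edge since G has diameter 2. Exploring H from that edge, either H
-- contains P₅, K₂ + P₃, P₃ + P₃ or 3K₂, or its non-trivial part is K₂, P₃, K₃, P₄, C₄ or 2K₂.
-- Each of the first four, padded with further vertices to six or seven, splits into three classes fewer
-- than it has vertices so that, with all other vertices as singletons, the partition is resolving and
-- dominating; so η_p(G) ≤ n − 3. This is checked by computing distances to the classes from the partial
-- adjacency information the configuration carries. If H is a single edge ab, the other vertices are
-- universal and need pairwise distinct classes, so with n − 2 classes both a and b share their class with
-- a universal vertex, and a cannot be told apart from its classmate. In the remaining cases G is the join of
-- a clique with the complement of the shape found.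
module Submission where

open import Defs
open import Algebra.Properties.CommutativeSemigroup using (interchange)
open import Data.Bool as Bool using (Bool; true; false; _∧_; not; if_then_else_)
open import Data.Bool.ListAction using (any)
open import Data.Bool.Properties using (¬-not)
open import Data.Empty using (⊥; ⊥-elim)
open import Data.Fin using (Fin; zero; suc; _≟_; splitAt; join; _↑ˡ_; _↑ʳ_; punchIn)
open import Data.Fin.Patterns using (0F; 1F; 2F; 3F; 4F; 5F; 6F)
open import Data.Fin.Permutation as Perm
  using (Permutation; Permutation′; _⟨$⟩ʳ_; _⟨$⟩ˡ_; _∘ₚ_; transpose; inverseˡ; inverseʳ)
import Data.Fin.Permutation.Components as PC
open import Data.Fin.Properties
  using (any?; all?; ¬∀⟶∃¬; pigeonhole; punchIn-injective; punchInᵢ≢i; <⇒≢; suc-injective; injective⇒≤;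
         ↑ˡ-injective; ↑ʳ-injective; splitAt-↑ˡ; splitAt-↑ʳ; splitAt⁻¹-↑ˡ; splitAt⁻¹-↑ʳ)
open import Data.List as List using (List; []; _∷_; foldr; allFin; tabulate)
open import Data.List.Membership.Propositional using (_∈_)
open import Data.List.Membership.Propositional.Properties using (∈-allFin; ∈-filter⁻)
open import Data.List.Properties using (map-tabulate)
open import Data.List.Relation.Unary.All as All using (All; []; _∷_)
import Data.List.Relation.Unary.All.Properties as All
open import Data.List.Relation.Unary.AllPairs using ([]; _∷_)
open import Data.List.Relation.Unary.Any as Any using (here; there)
open import Data.List.Relation.Unary.Unique.Propositional using () renaming (Unique to ListUnique)
open import Data.List.Relation.Unary.Unique.Propositional.Properties using (filter⁺; allFin⁺)
open import Data.Maybe using (Maybe; just; nothing)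
import Data.Maybe.Properties as Maybe
open import Data.Nat as ℕ using (ℕ; zero; suc; _+_; _∸_; _⊓_; _≤_; _<_; z≤n; s≤s)
open import Data.Nat.ListAction using (sum)
open import Data.Nat.Properties
  using (≤-refl; ≤-reflexive; ≤-trans; ≤-antisym; <-irrefl; <⇒≱; n≤1+n; n<1+n; n≤0⇒n≡0; m≤m+n; m≤n+m;
         +-comm; +-mono-≤; +-monoˡ-≤; +-monoʳ-<; m⊓n≤m; m⊓n≤n; ⊓-glb;
         m∸n+n≡m; m≤n+m∸n; m∸n≡0⇒m≤n; +-∸-assoc; +-commutativeSemigroup; module ≤-Reasoning)
open import Data.Product using (Σ; _×_; _,_; ∃; proj₁; proj₂)
open import Data.Product.Properties using () renaming (≡-dec to ×-≡-dec)
open import Data.Sum as Sum using (_⊎_; inj₁; inj₂)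
open import Data.Unit using (tt)
open import Data.Vec as Vec using (Vec; []; _∷_)
open import Data.Vec.Relation.Unary.All as VecAll using ([]; _∷_)
import Data.Vec.Relation.Unary.All.Properties as VecAll
open import Data.Vec.Relation.Unary.AllPairs using ([]; _∷_)
open import Data.Vec.Relation.Unary.Unique.Propositional using (Unique)
open import Data.Vec.Relation.Unary.Unique.Propositional.Properties using (lookup-injective)
open import Function using (_∘_)
open import Function.Definitions using (Injective)
open import Relation.Binary.PropositionalEquality
  using (_≡_; _≢_; refl; sym; trans; cong; cong₂; subst; ≢-sym; module ≡-Reasoning)
open import Relation.Nullary using (¬_; Dec; yes; no; contradiction)
open import Relation.Nullary.Decidable
  using (⌊_⌋; True; toWitness; dec-true; dec-false; ¬?; _×-dec_; _→-dec_; _⊎-dec_)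

-- Counting

∑ : ∀ {n} → (Fin n → ℕ) → ℕ
∑ f = sum (tabulate f)

∑-mono-≤ : ∀ {n} {f g : Fin n → ℕ} → (∀ i → f i ≤ g i) → ∑ f ≤ ∑ g
∑-mono-≤ {zero}  f≤g = z≤n
∑-mono-≤ {suc n} f≤g = +-mono-≤ (f≤g zero) (∑-mono-≤ (f≤g ∘ suc))

∑-+ : ∀ {n} (f g : Fin n → ℕ) → ∑ (λ i → f i + g i) ≡ ∑ f + ∑ g
∑-+ {zero}  f g = refl
∑-+ {suc n} f g = begin
  f zero + g zero + ∑ (λ i → f (suc i) + g (suc i))  ≡⟨ cong (f zero + g zero +_) (∑-+ (f ∘ suc) (g ∘ suc)) ⟩
  f zero + g zero + (∑ (f ∘ suc) + ∑ (g ∘ suc))      ≡⟨ interchange +-commutativeSemigroup (f zero) (g zero) _ _ ⟩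
  f zero + ∑ (f ∘ suc) + (g zero + ∑ (g ∘ suc))      ∎
  where open ≡-Reasoning

∑-zero : ∀ {n} {f : Fin n → ℕ} → (∀ i → f i ≡ 0) → ∑ f ≡ 0
∑-zero {zero}  f≡0 = refl
∑-zero {suc n} f≡0 = cong₂ _+_ (f≡0 zero) (∑-zero (f≡0 ∘ suc))

∑-single : ∀ {n} {f : Fin n → ℕ} x → (∀ i → i ≢ x → f i ≡ 0) → ∑ f ≡ f x
∑-single {suc n} {f} zero    f≡0 =
  trans (cong (f zero +_) (∑-zero (λ i → f≡0 (suc i) λ ()))) (+-comm (f zero) 0)
∑-single {suc n} {f} (suc x) f≡0 =
  cong₂ _+_ (f≡0 zero λ ()) (∑-single x (λ i i≢x → f≡0 (suc i) (i≢x ∘ suc-injective)))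

∑-ones : ∀ {n} → ∑ {n} (λ _ → 1) ≡ n
∑-ones {zero}  = refl
∑-ones {suc n} = cong suc ∑-ones

indicator : Bool → ℕ
indicator b = if b then 1 else 0

indicator≤1 : ∀ b → indicator b ≤ 1
indicator≤1 true  = ≤-refl
indicator≤1 false = z≤n

≟-diag : ∀ {n} (x : Fin n) → ⌊ x ≟ x ⌋ ≡ true
≟-diag x with x ≟ x
... | yes _   = refl
... | no x≢x = contradiction refl x≢x

≟-off : ∀ {n} {x y : Fin n} → x ≢ y → ⌊ x ≟ y ⌋ ≡ false
≟-off {x = x} {y} x≢y with x ≟ y
... | yes x≡y = contradiction x≡y x≢y
... | no _    = refl

∑-point : ∀ {n} (x : Fin n) → ∑ (λ w → indicator ⌊ x ≟ w ⌋) ≡ 1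
∑-point x = trans (∑-single x (λ i i≢x → cong indicator (≟-off (≢-sym i≢x))))
                  (cong indicator (≟-diag x))

occurrences : ∀ {n k} → Vec (Fin n) k → Fin n → ℕ
occurrences []       w = 0
occurrences (x ∷ xs) w = indicator ⌊ x ≟ w ⌋ + occurrences xs w

∑-occurrences : ∀ {n k} (xs : Vec (Fin n) k) → ∑ (occurrences xs) ≡ k
∑-occurrences {n} []  = ∑-zero {n} (λ _ → refl)
∑-occurrences (x ∷ xs) = trans (∑-+ (λ w → indicator ⌊ x ≟ w ⌋) (occurrences xs))
                               (cong₂ _+_ (∑-point x) (∑-occurrences xs))

occurrences-∉ : ∀ {n k} {w : Fin n} {xs : Vec (Fin n) k} → VecAll.All (w ≢_) xs → occurrences xs w ≡ 0
occurrences-∉ []           = refl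
occurrences-∉ (w≢x ∷ w∉xs) = cong₂ _+_ (cong indicator (≟-off (≢-sym w≢x))) (occurrences-∉ w∉xs)

deg≡∑ : ∀ {n} (G : Adj n) v → deg G v ≡ ∑ (λ w → indicator (G v w))
deg≡∑ G v = cong sum (map-tabulate (λ w → w) (λ w → indicator (G v w)))

deg+nonNeighbours≤n : ∀ {n} (G : Adj n) v {k} (xs : Vec (Fin n) k) →
  Unique xs → VecAll.All (λ x → G v x ≡ false) xs → deg G v + k ≤ n
deg+nonNeighbours≤n {n} G v {k} xs xs! non = begin
  deg G v + k                                     ≡⟨ cong₂ _+_ (deg≡∑ G v) (sym (∑-occurrences xs)) ⟩
  ∑ (indicator ∘ G v) + ∑ (occurrences xs)        ≡⟨ sym (∑-+ (indicator ∘ G v) (occurrences xs)) ⟩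
  ∑ (λ w → indicator (G v w) + occurrences xs w)  ≤⟨ ∑-mono-≤ (pointwise xs xs! non) ⟩
  ∑ {n} (λ _ → 1)                                 ≡⟨ ∑-ones ⟩
  n                                               ∎
  where
  open ≤-Reasoning
  pointwise : ∀ {k} (xs : Vec (Fin n) k) → Unique xs → VecAll.All (λ x → G v x ≡ false) xs →
              ∀ w → indicator (G v w) + occurrences xs w ≤ 1
  pointwise [] _ _ w = subst (_≤ 1) (sym (+-comm (indicator (G v w)) 0)) (indicator≤1 (G v w))
  pointwise (x ∷ xs) (x∉xs ∷ xs!) (vx ∷ non) w with x ≟ w
  ... | yes refl rewrite vx | occurrences-∉ x∉xs = ≤-refl
  ... | no _ = pointwise xs xs! non w

fresh : ∀ {n k} (S : Vec (Fin n) k) → k < n → ∃ λ z → VecAll.All (z ≢_) S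
fresh {n} S k<n with all? (λ z → any? (λ i → Vec.lookup S i ≟ z))
... | yes covered = contradiction (injective⇒≤ index!) (<⇒≱ k<n)
  where
  index! : Injective _≡_ _≡_ (proj₁ ∘ covered)
  index! {z} {z'} eq = trans (sym (proj₂ (covered z))) (trans (cong (Vec.lookup S) eq) (proj₂ (covered z')))
... | no notCovered with ¬∀⟶∃¬ n _ (λ z → any? (λ i → Vec.lookup S i ≟ z)) notCovered
...   | z , z∉S = z , VecAll.lookup⁻ (λ i z≡Sᵢ → z∉S (i , sym z≡Sᵢ))

snoc₃-unique : ∀ {n k} {S : Vec (Fin n) k} {x m y} → Unique S → Unique (x ∷ m ∷ y ∷ []) →
               VecAll.All (x ≢_) S → VecAll.All (m ≢_) S → VecAll.All (y ≢_) S →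
               Unique (S Vec.++ x ∷ m ∷ y ∷ [])
snoc₃-unique []        xmy! []          []          []          = xmy!
snoc₃-unique (s∉ ∷ S!) xmy! (x≢s ∷ x∉) (m≢s ∷ m∉) (y≢s ∷ y∉) =
  VecAll.++⁺ s∉ (≢-sym x≢s ∷ ≢-sym m≢s ∷ ≢-sym y≢s ∷ []) ∷ snoc₃-unique S! xmy! x∉ m∉ y∉

pigeonholeAvoiding : ∀ {n k} → suc k < n → (c : Fin n → Fin k) (z : Fin n) →
                     ∃ λ u → ∃ λ w → u ≢ w × u ≢ z × w ≢ z × c u ≡ c w
pigeonholeAvoiding {suc _} (s≤s k<m) c z with pigeonhole k<m (c ∘ punchIn z)
... | i , j , i<j , cᵢ≡cⱼ =
  punchIn z i , punchIn z j , <⇒≢ i<j ∘ punchIn-injective z i j , punchInᵢ≢i z i , punchInᵢ≢i z j , cᵢ≡cⱼ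

-- Distances

if-true : ∀ {A : Set} {b} {x y : A} → b ≡ true → (if b then x else y) ≡ x
if-true refl = refl

if-false : ∀ {A : Set} {b} {x y : A} → b ≡ false → (if b then x else y) ≡ y
if-false refl = refl

any-true : ∀ {A : Set} (f : A → Bool) {xs x} → x ∈ xs → f x ≡ true → any f xs ≡ true
any-true f {y ∷ xs} (here refl) fx rewrite fx = refl
any-true f {y ∷ xs} (there x∈xs) fx with f y
... | true  = refl
... | false = any-true f x∈xs fx

any-false : ∀ {A : Set} (f : A → Bool) xs → (∀ x → f x ≡ false) → any f xs ≡ false
any-false f []       f≡false = refl
any-false f (x ∷ xs) f≡false rewrite f≡false x = any-false f xs f≡false

2≤n : ∀ {n} {u v : Fin n} → u ≢ v → 2 ≤ n
2≤n {suc zero}    {zero} {zero} u≢v = contradiction refl u≢v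
2≤n {suc (suc n)} _ = s≤s (s≤s z≤n)

reach₁ : ∀ {n} (G : Adj n) {u v} → u ≢ v → reach G 1 u v ≡ G u v
reach₁ {n} G {u} {v} u≢v rewrite ≟-off u≢v with G u v in uv
... | true  = any-true (λ w → ⌊ u ≟ w ⌋ ∧ G w v) (∈-allFin u) (trans (cong (_∧ G u v) (≟-diag u)) uv)
... | false = any-false (λ w → ⌊ u ≟ w ⌋ ∧ G w v) (allFin n) diagonalOnly
  where
  diagonalOnly : ∀ w → (⌊ u ≟ w ⌋ ∧ G w v) ≡ false
  diagonalOnly w with u ≟ w
  ... | yes refl = uv
  ... | no _     = refl

distFrom-≥ : ∀ {n} (G : Adj n) u v fuel k → k ≤ distFrom G u v fuel k
distFrom-≥ G u v zero       k = ≤-refl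
distFrom-≥ G u v (suc fuel) k with reach G k u v
... | true  = ≤-refl
... | false = ≤-trans (n≤1+n k) (distFrom-≥ G u v fuel (suc k))

dist-refl : ∀ {n} (G : Adj n) u → dist G u u ≡ 0
dist-refl {suc _} G u rewrite ≟-diag u = refl

1≤dist : ∀ {n} (G : Adj n) {u v} → u ≢ v → 1 ≤ dist G u v
1≤dist {suc m} G {u} {v} u≢v rewrite ≟-off u≢v = distFrom-≥ G u v m 1

dist-adjacent : ∀ {n} (G : Adj n) {u v} → u ≢ v → G u v ≡ true → dist G u v ≡ 1
dist-adjacent {suc zero}    G {zero} {zero} u≢v _ = contradiction refl u≢v
dist-adjacent {suc (suc _)} G u≢v uv =
  trans (if-false (≟-off u≢v)) (if-true (trans (reach₁ G u≢v) uv))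

2≤dist-nonadjacent : ∀ {n} (G : Adj n) {u v} → u ≢ v → G u v ≡ false → 2 ≤ dist G u v
2≤dist-nonadjacent {suc zero}    G {zero} {zero} u≢v _ = contradiction refl u≢v
2≤dist-nonadjacent {suc (suc m)} G {u} {v} u≢v uv =
  subst (2 ≤_) (sym (trans (if-false (≟-off u≢v)) (if-false (trans (reach₁ G u≢v) uv))))
        (distFrom-≥ G u v m 2)

module _ {n k} (G : Adj n) (c : Fin n → Fin k) where

  private
    minOver : Fin n → Fin k → ℕ → List (Fin n) → ℕ
    minOver v j = foldr (λ w acc → if ⌊ c w ≟ j ⌋ then dist G v w ⊓ acc else acc)

    minOver≤ : ∀ {v j w} d {ws} → w ∈ ws → c w ≡ j → minOver v j d ws ≤ dist G v w
    minOver≤ {v} {j} d {x ∷ ws} (here refl) refl rewrite ≟-diag (c x) = m⊓n≤m _ _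
    minOver≤ {v} {j} d {x ∷ ws} (there w∈ws) cw with ⌊ c x ≟ j ⌋
    ... | true  = ≤-trans (m⊓n≤n _ _) (minOver≤ d w∈ws cw)
    ... | false = minOver≤ d w∈ws cw

    ≤minOver : ∀ {v j m d} ws → m ≤ d → (∀ w → c w ≡ j → m ≤ dist G v w) → m ≤ minOver v j d ws
    ≤minOver         []       m≤d _   = m≤d
    ≤minOver {j = j} (x ∷ ws) m≤d m≤J with c x ≟ j
    ... | yes cx = ⊓-glb (m≤J x cx) (≤minOver ws m≤d m≤J)
    ... | no _   = ≤minOver ws m≤d m≤J

  setDist≤dist : ∀ {v j w} → c w ≡ j → setDist G c v j ≤ dist G v w
  setDist≤dist {w = w} = minOver≤ n (∈-allFin w)

  ≤setDist : ∀ {v j m} → m ≤ n → (∀ w → c w ≡ j → m ≤ dist G v w) → m ≤ setDist G c v j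
  ≤setDist = ≤minOver (allFin n)

  setDist-own : ∀ {v j} → c v ≡ j → setDist G c v j ≡ 0
  setDist-own {v} cv = n≤0⇒n≡0 (subst (setDist G c v _ ≤_) (dist-refl G v) (setDist≤dist cv))

  1≤setDist : ∀ {v j} → c v ≢ j → 1 ≤ setDist G c v j
  1≤setDist {v} {j} cv≢j = ≤setDist (1≤n v) (λ w cw → 1≤dist G λ v≡w → cv≢j (trans (cong c v≡w) cw))
    where
    1≤n : Fin n → 1 ≤ n
    1≤n zero    = s≤s z≤n
    1≤n (suc _) = s≤s z≤n

  setDist-adjacent : ∀ {v w j} → c v ≢ j → c w ≡ j → G v w ≡ true → setDist G c v j ≡ 1
  setDist-adjacent {v} cv≢j cw vw = ≤-antisym
    (subst (setDist G c v _ ≤_) (dist-adjacent G (λ v≡w → cv≢j (trans (cong c v≡w) cw)) vw) (setDist≤dist cw))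
    (1≤setDist cv≢j)

  setDist-nonadjacent : (∀ u v → dist G u v ≤ 2) → ∀ {v w j} → c v ≢ j → c w ≡ j →
                        (∀ w → c w ≡ j → G v w ≡ false) → setDist G c v j ≡ 2
  setDist-nonadjacent diam {v} {w} {j} cv≢j cw nonadj = ≤-antisym
    (≤-trans (setDist≤dist cw) (diam v w))
    (≤setDist (2≤n v≢w) (λ w' cw' → 2≤dist-nonadjacent G (v≢ cw') (nonadj w' cw')))
    where
    v≢ : ∀ {w'} → c w' ≡ j → v ≢ w'
    v≢ cw' v≡w' = cv≢j (trans (cong c v≡w') cw')
    v≢w : v ≢ w
    v≢w = v≢ cw

transpose-here : ∀ {m} (i j : Fin m) → PC.transpose i j i ≡ j
transpose-here i j rewrite dec-true (i ≟ i) refl = refl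

transpose-fixes : ∀ {m} {i j k : Fin m} → k ≢ i → k ≢ j → PC.transpose i j k ≡ k
transpose-fixes {i = i} {j} {k} k≢i k≢j rewrite dec-false (k ≟ i) k≢i | dec-false (k ≟ j) k≢j = refl

extendToBijection : ∀ {t m m'} (e : Fin t → Fin m) (d : Fin t → Fin m') → Injective _≡_ _≡_ e →
                    Injective _≡_ _≡_ d → m ≡ m' → Σ (Permutation m m') λ π → ∀ i → π ⟨$⟩ʳ e i ≡ d i
extendToBijection {zero}  e d _  _  refl = Perm.id , λ ()
extendToBijection {suc t} e d e! d! refl = π ∘ₚ transpose a (d zero) , sends
  where
  IH : Σ (Permutation′ _) λ π → ∀ i → π ⟨$⟩ʳ e (suc i) ≡ d (suc i)
  IH = extendToBijection (e ∘ suc) (d ∘ suc) (suc-injective ∘ e!) (suc-injective ∘ d!) refl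
  π : Permutation′ _
  π = proj₁ IH
  a : Fin _
  a = π ⟨$⟩ʳ e zero
  sends : ∀ i → PC.transpose a (d zero) (π ⟨$⟩ʳ e i) ≡ d i
  sends zero    = transpose-here a (d zero)
  sends (suc i) = trans (cong (PC.transpose a (d zero)) (proj₂ IH i)) (transpose-fixes ≢a ≢d0)
    where
    ≢a : d (suc i) ≢ a
    ≢a eq with e! (trans (sym (inverseˡ π)) (trans (cong (π ⟨$⟩ˡ_) (trans (proj₂ IH i) eq)) (inverseˡ π)))
    ... | ()
    ≢d0 : d (suc i) ≢ d zero
    ≢d0 eq with d! eq
    ... | ()

module Embedding {n t} (e : Fin t → Fin n) (e! : Injective _≡_ _≡_ e) where

  m : ℕ
  m = n ∸ t

  private
    extension : Σ (Permutation n (m + t)) λ π → ∀ i → π ⟨$⟩ʳ e i ≡ m ↑ʳ i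
    extension = extendToBijection e (m ↑ʳ_) e! (↑ʳ-injective m _ _) (sym (m∸n+n≡m (injective⇒≤ e!)))

  π : Permutation n (m + t)
  π = proj₁ extension

  π! : ∀ {u w} → π ⟨$⟩ʳ u ≡ π ⟨$⟩ʳ w → u ≡ w
  π! {u} {w} eq = trans (sym (inverseˡ π)) (trans (cong (π ⟨$⟩ˡ_) eq) (inverseˡ π))

  splitAt-image : ∀ i → splitAt m (π ⟨$⟩ʳ e i) ≡ inj₂ i
  splitAt-image i = trans (cong (splitAt m) (proj₂ extension i)) (splitAt-↑ʳ m t i)

  data Position (u : Fin n) : Set where
    image   : ∀ i → e i ≡ u → Position u
    outside : ∀ k → splitAt m (π ⟨$⟩ʳ u) ≡ inj₁ k → Position u

  position : ∀ u → Position u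
  position u with splitAt m (π ⟨$⟩ʳ u) in eq
  ... | inj₁ k = outside k eq
  ... | inj₂ i = image i (π! (trans (proj₂ extension i) (splitAt⁻¹-↑ʳ eq)))

  outside-unique : ∀ {u w k} → splitAt m (π ⟨$⟩ʳ u) ≡ inj₁ k → splitAt m (π ⟨$⟩ʳ w) ≡ inj₁ k → u ≡ w
  outside-unique u↦k w↦k = π! (trans (sym (splitAt⁻¹-↑ˡ u↦k)) (splitAt⁻¹-↑ˡ w↦k))

  outside-∉ : ∀ {u k} → splitAt m (π ⟨$⟩ʳ u) ≡ inj₁ k → ∀ i → e i ≢ u
  outside-∉ u↦k i refl with trans (sym (splitAt-image i)) u↦k
  ... | ()

  outsideOf : ∀ k → Σ (Fin n) λ u → splitAt m (π ⟨$⟩ʳ u) ≡ inj₁ k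
  outsideOf k = π ⟨$⟩ˡ (k ↑ˡ t) , trans (cong (splitAt m) (inverseʳ π)) (splitAt-↑ˡ m k t)

↑ˡ≢↑ʳ : ∀ {m s} {k : Fin m} {l : Fin s} → k ↑ˡ s ≢ m ↑ʳ l
↑ˡ≢↑ʳ {m} {s} {k} {l} eq with trans (sym (splitAt-↑ˡ m k s)) (trans (cong (splitAt m) eq) (splitAt-↑ʳ m s l))
... | ()

-- Partitions built from partial knowledge of adjacency

-- K i j ≡ just b records that the i-th and j-th vertex are adjacent iff b; nothing means unknown.
Knowledge : ℕ → Set
Knowledge t = Fin t → Fin t → Maybe Bool

private
  distanceFrom : ∀ {A B C : Set} → Dec A → Dec B → Dec C → Maybe ℕ
  distanceFrom (yes _) _       _       = just 0
  distanceFrom (no _)  (yes _) _       = just 1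
  distanceFrom (no _)  (no _)  (yes _) = just 2
  distanceFrom (no _)  (no _)  (no _)  = nothing

Differ : Maybe ℕ → Maybe ℕ → Set
Differ (just x) (just y) = x ≢ y
Differ _        _        = ⊥

differ? : ∀ a b → Dec (Differ a b)
differ? (just x) (just y) = ¬? (x ℕ.≟ y)
differ? (just _) nothing  = no λ ()
differ? nothing  _        = no λ ()

module _ {t s} (K : Knowledge t) (p : Fin t → Fin s) where

  AdjacentInClass : Fin t → Fin s → Set
  AdjacentInClass i l = ∃ λ j → p j ≡ l × K i j ≡ just true

  NonAdjacentToClass : Fin t → Fin s → Set
  NonAdjacentToClass i l = ∀ j → p j ≡ l → K i j ≡ just false

  adjacentInClass? : ∀ i l → Dec (AdjacentInClass i l)
  adjacentInClass? i l = any? λ j → p j ≟ l ×-dec Maybe.≡-dec Bool._≟_ (K i j) (just true)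

  nonAdjacentToClass? : ∀ i l → Dec (NonAdjacentToClass i l)
  nonAdjacentToClass? i l = all? λ j → p j ≟ l →-dec Maybe.≡-dec Bool._≟_ (K i j) (just false)

  knownDist : Fin t → Fin s → Maybe ℕ
  knownDist i l = distanceFrom (p i ≟ l) (adjacentInClass? i l) (nonAdjacentToClass? i l)

  Covers : Set
  Covers = ∀ l → ∃ λ i → p i ≡ l

  Resolves : Set
  Resolves = ∀ i j → i ≢ j → p i ≡ p j → ∃ λ l → Differ (knownDist i l) (knownDist j l)

  Dominates : Set
  Dominates = ∀ i → ∃ λ j → p j ≢ p i × K i j ≡ just true

  IsPartitionPattern : Set
  IsPartitionPattern = Covers × Resolves × Dominates

  isPartitionPattern? : Dec IsPartitionPattern
  isPartitionPattern? =
    (all? λ l → any? λ i → p i ≟ l) ×-dec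
    (all? λ i → all? λ j → ¬? (i ≟ j) →-dec
                            (p i ≟ p j →-dec any? λ l → differ? (knownDist i l) (knownDist j l))) ×-dec
    (all? λ i → any? λ j → ¬? (p j ≟ p i) ×-dec Maybe.≡-dec Bool._≟_ (K i j) (just true))

-- The image of e is split into the classes p; every other vertex forms a class of its own.
module PatternPartition {n} (G : Adj n) (diam : ∀ u v → dist G u v ≤ 2)
  (neighbour : ∀ v → ∃ λ w → w ≢ v × G v w ≡ true)
  {t s} (e : Fin t → Fin n) (e! : Injective _≡_ _≡_ e)
  (K : Knowledge t) (K-sound : ∀ {i j b} → K i j ≡ just b → G (e i) (e j) ≡ b)
  (p : Fin t → Fin s) (valid : IsPartitionPattern K p) where

  open Embedding e e!

  covers : Covers K p
  covers = proj₁ valid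

  class : Fin n → Fin (m + s)
  class u = join m s (Sum.map₂ p (splitAt m (π ⟨$⟩ʳ u)))

  class-image : ∀ i → class (e i) ≡ m ↑ʳ p i
  class-image i = cong (join m s ∘ Sum.map₂ p) (splitAt-image i)

  class-outside : ∀ {u k} → splitAt m (π ⟨$⟩ʳ u) ≡ inj₁ k → class u ≡ k ↑ˡ s
  class-outside u↦k = cong (join m s ∘ Sum.map₂ p) u↦k

  members : ∀ {w l} → class w ≡ m ↑ʳ l → ∃ λ j → e j ≡ w × p j ≡ l
  members {w} cw with position w
  ... | image j refl   = j , refl , ↑ʳ-injective m _ _ (trans (sym (class-image j)) cw)
  ... | outside k w↦k = contradiction (trans (sym (class-outside w↦k)) cw) ↑ˡ≢↑ʳ

  sameClass : ∀ {u w} → u ≢ w → class u ≡ class w → ∃ λ i → ∃ λ j → e i ≡ u × e j ≡ w × p i ≡ p j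
  sameClass {u} {w} u≢w cu≡cw with position u | position w
  ... | image i refl   | image j refl    =
    i , j , refl , refl , ↑ʳ-injective m _ _ (trans (sym (class-image i)) (trans cu≡cw (class-image j)))
  ... | image i refl   | outside k w↦k  =
    contradiction (trans (sym (class-outside w↦k)) (trans (sym cu≡cw) (class-image i))) ↑ˡ≢↑ʳ
  ... | outside k u↦k | image j refl    =
    contradiction (trans (sym (class-outside u↦k)) (trans cu≡cw (class-image j))) ↑ˡ≢↑ʳ
  ... | outside k u↦k | outside k' w↦k' =
    contradiction (outside-unique u↦k (subst (λ x → splitAt m (π ⟨$⟩ʳ w) ≡ inj₁ x) (sym k≡k') w↦k')) u≢w
    where
    k≡k' : k ≡ k'
    k≡k' = ↑ˡ-injective s k k' (trans (sym (class-outside u↦k)) (trans cu≡cw (class-outside w↦k')))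

  knownDist-sound : ∀ {i l x} → knownDist K p i l ≡ just x → setDist G class (e i) (m ↑ʳ l) ≡ x
  knownDist-sound {i} {l} = sound (p i ≟ l) (adjacentInClass? K p i l) (nonAdjacentToClass? K p i l)
    where
    ≢class : p i ≢ l → class (e i) ≢ m ↑ʳ l
    ≢class pi≢l eq = pi≢l (↑ʳ-injective m _ _ (trans (sym (class-image i)) eq))
    sound : ∀ {x} (d₀ : Dec (p i ≡ l)) (d₁ : Dec (AdjacentInClass K p i l))
            (d₂ : Dec (NonAdjacentToClass K p i l)) →
            distanceFrom d₀ d₁ d₂ ≡ just x → setDist G class (e i) (m ↑ʳ l) ≡ x
    sound (yes refl) _ _ refl = setDist-own G class (class-image i)
    sound (no pi≢l) (yes (j , refl , Kij)) _ refl =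
      setDist-adjacent G class (≢class pi≢l) (class-image j) (K-sound Kij)
    sound (no pi≢l) (no _) (yes nonadjacent) refl =
      setDist-nonadjacent G class diam (≢class pi≢l) (trans (class-image j₀) (cong (m ↑ʳ_) pj₀≡l))
                          nonadjacent′
      where
      j₀ : Fin t
      j₀ = proj₁ (covers l)
      pj₀≡l : p j₀ ≡ l
      pj₀≡l = proj₂ (covers l)
      nonadjacent′ : ∀ w → class w ≡ m ↑ʳ l → G (e i) w ≡ false
      nonadjacent′ w cw with members cw
      ... | j , refl , pj≡l = K-sound (nonadjacent j pj≡l)

  differ-sound : ∀ {i j l} → Differ (knownDist K p i l) (knownDist K p j l) →
                 setDist G class (e i) (m ↑ʳ l) ≢ setDist G class (e j) (m ↑ʳ l)
  differ-sound {i} {j} {l} with knownDist K p i l in dᵢ | knownDist K p j l in dⱼ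
  ... | just x  | just y  = λ x≢y same →
    x≢y (trans (sym (knownDist-sound dᵢ)) (trans same (knownDist-sound dⱼ)))
  ... | just _  | nothing = λ ()
  ... | nothing | _       = λ ()

  resolving : IsResolving G class
  resolving u w same with u ≟ w
  ... | yes u≡w = u≡w
  ... | no u≢w with class u ≟ class w
  ...   | no cu≢cw = contradiction
    (subst (1 ≤_) (trans (sym (same (class u))) (setDist-own G class refl)) (1≤setDist G class (cu≢cw ∘ sym)))
    λ ()
  ...   | yes cu≡cw with sameClass u≢w cu≡cw
  ...     | i , j , refl , refl , pi≡pj with proj₁ (proj₂ valid) i j (u≢w ∘ cong e) pi≡pj
  ...       | l , differ = contradiction (same (m ↑ʳ l)) (differ-sound differ)

  dominating : IsDominating G class
  dominating u with position u
  ... | image i refl with proj₂ (proj₂ valid) i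
  ...   | j , pj≢pi , Kij = class (e j) , setDist-adjacent G class ci≢cj refl (K-sound Kij)
    where
    ci≢cj : class (e i) ≢ class (e j)
    ci≢cj eq = pj≢pi (↑ʳ-injective m _ _ (trans (sym (class-image j)) (trans (sym eq) (class-image i))))
  dominating u | outside k u↦k with neighbour u
  ...   | w , w≢u , uw = class w , setDist-adjacent G class cu≢cw refl uw
    where
    cu≢cw : class u ≢ class w
    cu≢cw eq with sameClass (w≢u ∘ sym) eq
    ... | i , _ , ei≡u , _ = outside-∉ u↦k i ei≡u

  partition : IsPartition class
  partition J with splitAt m J in eq
  ... | inj₁ k = proj₁ (outsideOf k) , trans (class-outside (proj₂ (outsideOf k))) (splitAt⁻¹-↑ˡ eq)
  ... | inj₂ l with covers l
  ...   | i , pi≡l = e i , trans (class-image i) (trans (cong (m ↑ʳ_) pi≡l) (splitAt⁻¹-↑ʳ eq))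

  resDomPartition : Σ (Fin n → Fin (n ∸ t + s)) (IsResDomPartition G)
  resDomPartition = class , partition , resolving , dominating

-- Joins with a clique

joinAdj : ∀ {a b} → Adj a → Adj b → Fin a ⊎ Fin b → Fin a ⊎ Fin b → Bool
joinAdj H Q (inj₁ x) (inj₁ y) = H x y
joinAdj H Q (inj₂ x) (inj₂ y) = Q x y
joinAdj H Q (inj₁ _) (inj₂ _) = true
joinAdj H Q (inj₂ _) (inj₁ _) = true

⋁-splitAt : ∀ {a b} (H : Adj a) (Q : Adj b) x y → (H ⋁ Q) x y ≡ joinAdj H Q (splitAt a x) (splitAt a y)
⋁-splitAt {a} H Q x y with splitAt a x | splitAt a y
... | inj₁ _ | inj₁ _ = refl
... | inj₂ _ | inj₂ _ = refl
... | inj₁ _ | inj₂ _ = refl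
... | inj₂ _ | inj₁ _ = refl

joinIsomorphism : ∀ {n t} (G : Adj n) → IsGraph G → (e : Fin t → Fin n) → Injective _≡_ _≡_ e → (Q : Adj t) →
                  (∀ i j → G (e i) (e j) ≡ Q i j) → (∀ u → (∀ i → e i ≢ u) → ∀ w → w ≢ u → G u w ≡ true) →
                  G ≅ (complete (n ∸ t) ⋁ Q)
joinIsomorphism {n} {t} G (gsym , gloop) e e! Q e-Q universal = π , λ u w →
  trans (byPosition (position u) (position w)) (sym (⋁-splitAt (complete m) Q (π ⟨$⟩ʳ u) (π ⟨$⟩ʳ w)))
  where
  open Embedding e e!
  byPosition : ∀ {u w} → Position u → Position w →
               G u w ≡ joinAdj (complete m) Q (splitAt m (π ⟨$⟩ʳ u)) (splitAt m (π ⟨$⟩ʳ w))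
  byPosition (image i refl) (image j refl) rewrite splitAt-image i | splitAt-image j = e-Q i j
  byPosition (image i refl) (outside k w↦k) rewrite splitAt-image i | w↦k =
    trans (gsym _ _) (universal _ (outside-∉ w↦k) (e i) (outside-∉ w↦k i))
  byPosition (outside k u↦k) (image j refl) rewrite u↦k | splitAt-image j =
    universal _ (outside-∉ u↦k) (e j) (outside-∉ u↦k j)
  byPosition {u} {w} (outside k u↦k) (outside k' w↦k') rewrite u↦k | w↦k' with u ≟ w
  ... | yes refl with trans (sym u↦k) w↦k'
  ...   | refl = trans (gloop u) (cong not (sym (≟-diag k)))
  byPosition {u} {w} (outside k u↦k) (outside k' w↦k') | no u≢w =
    trans (universal u (outside-∉ u↦k) w (u≢w ∘ sym)) (cong not (sym (≟-off k≢k')))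
    where
    k≢k' : k ≢ k'
    k≢k' refl = u≢w (outside-unique u↦k w↦k')

-- Some non-adjacent pairs among finitely many vertices (edges of the complement, whose shape names the
-- configurations below), and closed vertices, all of whose non-neighbours are among their listed partners.
record Configuration : Set where
  field
    size           : ℕ
    nonEdges       : List (Fin size × Fin size)
    closedVertices : List (Fin size)

private
  adjacencyFrom : ∀ {A B C D : Set} → Dec A → Dec B → Dec C → Dec D → Maybe Bool
  adjacencyFrom (yes _) _       _       _       = just false
  adjacencyFrom (no _)  (yes _) _       _       = just false
  adjacencyFrom (no _)  (no _)  (yes _) _       = just true
  adjacencyFrom (no _)  (no _)  (no _)  (yes _) = just true
  adjacencyFrom (no _)  (no _)  (no _)  (no _)  = nothing

module _ (C : Configuration) where
  open Configuration C

  NonEdge : Fin size → Fin size → Set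
  NonEdge i j = (i , j) ∈ nonEdges ⊎ (j , i) ∈ nonEdges

  nonEdge? : ∀ i j → Dec (NonEdge i j)
  nonEdge? i j = Any.any? (×-≡-dec _≟_ _≟_ (i , j)) nonEdges ⊎-dec Any.any? (×-≡-dec _≟_ _≟_ (j , i)) nonEdges

  partners : Fin size → List (Fin size)
  partners i = List.filter (λ j → ¬? (i ≟ j) ×-dec nonEdge? i j) (allFin size)

  -- Vertices with two partners are closed in every realisation, as no vertex has three non-neighbours.
  Saturated : Fin size → Set
  Saturated i = i ∈ closedVertices ⊎ 2 ≤ List.length (partners i)

  saturated? : ∀ i → Dec (Saturated i)
  saturated? i = Any.any? (i ≟_) closedVertices ⊎-dec (2 ℕ.≤? List.length (partners i))

  known : Knowledge size
  known i j = adjacencyFrom (i ≟ j) (nonEdge? i j) (saturated? i) (saturated? j)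

  IsClosedComponent : Adj size → Set
  IsClosedComponent Q = (∀ i → Saturated i) × (∀ i j → known i j ≡ just (Q i j))

  isClosedComponent? : ∀ Q → Dec (IsClosedComponent Q)
  isClosedComponent? Q =
    all? saturated? ×-dec all? λ i → all? λ j → Maybe.≡-dec Bool._≟_ (known i j) (just (Q i j))

NonEdge-sym : ∀ {C i j} → NonEdge C i j → NonEdge C j i
NonEdge-sym = Sum.swap

-- A realisation of a small pattern in G yields a resolving dominating partition with n ∸ 3 classes.
record SmallPattern : Set where
  field
    configuration : Configuration
    classes       : ℕ
    class         : Fin (Configuration.size configuration) → Fin classes
    size≡         : Configuration.size configuration ≡ classes + 3
    valid         : True (isPartitionPattern? (known configuration) class)

fewerClasses : ∀ {n s} → s + 3 ≤ n → n ∸ (s + 3) + s < n ∸ 2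
fewerClasses {n} {s} s+3≤n = begin-strict
  r + s             <⟨ +-monoʳ-< r (n<1+n s) ⟩
  r + suc s         ≡⟨ cong (r +_) (+-comm 1 s) ⟩
  r + (s + 1)       ≡⟨ cong (r +_) (sym (+-∸-assoc s (n≤1+n 2))) ⟩
  r + (s + 3 ∸ 2)   ≡⟨ sym (+-∸-assoc r (≤-trans (n≤1+n 2) (m≤n+m 3 s))) ⟩
  r + (s + 3) ∸ 2   ≡⟨ cong (_∸ 2) (m∸n+n≡m s+3≤n) ⟩
  n ∸ 2             ∎
  where
  open ≤-Reasoning
  r : ℕ
  r = n ∸ (s + 3)

path₅-pattern : SmallPattern
path₅-pattern = record
  { configuration = record
    { size = 6 ; nonEdges = (1F , 2F) ∷ (2F , 3F) ∷ (3F , 4F) ∷ (4F , 5F) ∷ [] ; closedVertices = [] }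
  ; classes = 3
  ; class   = Vec.lookup (1F ∷ 0F ∷ 1F ∷ 0F ∷ 2F ∷ 1F ∷ [])
  ; size≡   = refl
  ; valid   = tt
  }

edge-path₃-pattern : SmallPattern
edge-path₃-pattern = record
  { configuration = record
    { size = 7 ; nonEdges = (2F , 3F) ∷ (4F , 5F) ∷ (5F , 6F) ∷ [] ; closedVertices = 2F ∷ 3F ∷ [] }
  ; classes = 4
  ; class   = Vec.lookup (3F ∷ 0F ∷ 0F ∷ 1F ∷ 0F ∷ 2F ∷ 3F ∷ [])
  ; size≡   = refl
  ; valid   = tt
  }

path₃-path₃-pattern : SmallPattern
path₃-path₃-pattern = record
  { configuration = record
    { size = 7 ; nonEdges = (1F , 2F) ∷ (2F , 3F) ∷ (4F , 5F) ∷ (5F , 6F) ∷ [] ; closedVertices = [] }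
  ; classes = 4
  ; class   = Vec.lookup (0F ∷ 0F ∷ 1F ∷ 2F ∷ 0F ∷ 3F ∷ 2F ∷ [])
  ; size≡   = refl
  ; valid   = tt
  }

three-edges-pattern : SmallPattern
three-edges-pattern = record
  { configuration = record
    { size = 7 ; nonEdges = (1F , 2F) ∷ (3F , 5F) ∷ (4F , 6F) ∷ []
    ; closedVertices = 1F ∷ 2F ∷ 3F ∷ 4F ∷ 5F ∷ 6F ∷ [] }
  ; classes = 4
  ; class   = Vec.lookup (0F ∷ 0F ∷ 1F ∷ 0F ∷ 0F ∷ 2F ∷ 3F ∷ [])
  ; size≡   = refl
  ; valid   = tt
  }

path₃-component : Configuration
path₃-component = record
  { size = 3 ; nonEdges = (0F , 2F) ∷ (1F , 2F) ∷ [] ; closedVertices = 0F ∷ 1F ∷ [] }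

path₃-closed : IsClosedComponent path₃-component (complete 2 ⊕ complete 1)
path₃-closed = toWitness {a? = isClosedComponent? path₃-component _} tt

triangle-component : Configuration
triangle-component = record
  { size = 3 ; nonEdges = (0F , 1F) ∷ (1F , 2F) ∷ (0F , 2F) ∷ [] ; closedVertices = [] }

triangle-closed : IsClosedComponent triangle-component (edgeless 3)
triangle-closed = toWitness {a? = isClosedComponent? triangle-component _} tt

path₄-component : Configuration
path₄-component = record
  { size = 4 ; nonEdges = (2F , 0F) ∷ (0F , 3F) ∷ (3F , 1F) ∷ [] ; closedVertices = 1F ∷ 2F ∷ [] }

path₄-closed : IsClosedComponent path₄-component path4
path₄-closed = toWitness {a? = isClosedComponent? path₄-component _} tt

cycle₄-component : Configuration
cycle₄-component = record
  { size = 4 ; nonEdges = (0F , 2F) ∷ (2F , 1F) ∷ (1F , 3F) ∷ (3F , 0F) ∷ [] ; closedVertices = [] }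

cycle₄-closed : IsClosedComponent cycle₄-component twoK2
cycle₄-closed = toWitness {a? = isClosedComponent? cycle₄-component _} tt

two-edges-component : Configuration
two-edges-component = record
  { size = 4 ; nonEdges = (0F , 2F) ∷ (1F , 3F) ∷ [] ; closedVertices = 0F ∷ 1F ∷ 2F ∷ 3F ∷ [] }

two-edges-closed : IsClosedComponent two-edges-component cycle4
two-edges-closed = toWitness {a? = isClosedComponent? two-edges-component _} tt

-- Graphs whose complement has maximum degree at most 2

module DenseGraph {n} (G : Adj n) (graph : IsGraph G) (mindeg : MinDegreeAtLeast G (n ∸ 3)) where

  gsym : ∀ u v → G u v ≡ G v u
  gsym = proj₁ graph

  gloop : ∀ u → G u u ≡ false
  gloop = proj₂ graph

  AdjacentToAllExcept : Fin n → List (Fin n) → Set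
  AdjacentToAllExcept v ps = ∀ w → w ≢ v → All (w ≢_) ps → G v w ≡ true

  saturation : ∀ {v x y} → Unique (v ∷ x ∷ y ∷ []) → G v x ≡ false → G v y ≡ false →
               AdjacentToAllExcept v (x ∷ y ∷ [])
  saturation {v} {x} {y} v! vx vy w w≢v (w≢x ∷ w≢y ∷ []) with G v w in vw
  ... | true  = refl
  ... | false = contradiction
    (deg+nonNeighbours≤n G v (w ∷ v ∷ x ∷ y ∷ []) ((w≢v ∷ w≢x ∷ w≢y ∷ []) ∷ v!) (vw ∷ gloop v ∷ vx ∷ vy ∷ []))
    ¬deg+4≤n
    where
    open ≤-Reasoning
    ¬deg+4≤n : ¬ (deg G v + 4 ≤ n)
    ¬deg+4≤n le = <-irrefl refl (begin-strict
      n               ≤⟨ m≤n+m∸n n 3 ⟩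
      3 + (n ∸ 3)     <⟨ n<1+n _ ⟩
      4 + (n ∸ 3)     ≡⟨ +-comm 4 (n ∸ 3) ⟩
      n ∸ 3 + 4       ≤⟨ +-monoˡ-≤ 4 (mindeg v) ⟩
      deg G v + 4     ≤⟨ le ⟩
      n               ∎)

  neighbour : 4 ≤ n → ∀ v → ∃ λ w → w ≢ v × G v w ≡ true
  neighbour 4≤n v with any? (λ w → G v w Bool.≟ true)
  ... | yes (w , vw) = w , (λ { refl → contradiction (trans (sym vw) (gloop v)) λ () }) , vw
  ... | no isolated  = contradiction (m∸n≡0⇒m≤n (n≤0⇒n≡0 (subst (n ∸ 3 ≤_) deg≡0 (mindeg v)))) (<⇒≱ 4≤n)
    where
    deg≡0 : deg G v ≡ 0
    deg≡0 = trans (deg≡∑ G v) (∑-zero noNeighbour)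
      where
      noNeighbour : ∀ w → indicator (G v w) ≡ 0
      noNeighbour w with G v w in vw
      ... | true  = contradiction (w , vw) isolated
      ... | false = refl

  CompleteOutside : ∀ {k} → Vec (Fin n) k → Set
  CompleteOutside S = ∀ u w → VecAll.All (u ≢_) S → VecAll.All (w ≢_) S → u ≢ w → G u w ≡ true

  record Realisation (C : Configuration) : Set where
    field
      vertices    : Vec (Fin n) (Configuration.size C)
      distinct    : Unique vertices
      nonAdjacent : All (λ ij → G (Vec.lookup vertices (proj₁ ij)) (Vec.lookup vertices (proj₂ ij)) ≡ false)
                        (Configuration.nonEdges C)
      closed      : All (λ i → AdjacentToAllExcept (Vec.lookup vertices i)
                                                   (List.map (Vec.lookup vertices) (partners C i)))
                        (Configuration.closedVertices C)

  module _ {C : Configuration} (R : Realisation C) where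
    open Configuration C
    open Realisation R

    vertex : Fin size → Fin n
    vertex = Vec.lookup vertices

    vertex! : Injective _≡_ _≡_ vertex
    vertex! = lookup-injective distinct _ _

    nonEdge⇒nonAdjacent : ∀ {i j} → NonEdge C i j → G (vertex i) (vertex j) ≡ false
    nonEdge⇒nonAdjacent (inj₁ ij∈) = All.lookup nonAdjacent ij∈
    nonEdge⇒nonAdjacent (inj₂ ji∈) = trans (gsym _ _) (All.lookup nonAdjacent ji∈)

    partner : ∀ {i j} → j ∈ partners C i → i ≢ j × NonEdge C i j
    partner {i} = proj₂ ∘ ∈-filter⁻ (λ j → ¬? (i ≟ j) ×-dec nonEdge? C i j) {xs = allFin size}

    outsidePartners : ∀ {i j} → ¬ NonEdge C i j → All (vertex j ≢_) (List.map vertex (partners C i))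
    outsidePartners {i} ¬ij = All.map⁺ (All.tabulate λ x∈ vj≡vx →
      ¬ij (subst (NonEdge C i) (sym (vertex! vj≡vx)) (proj₂ (partner x∈))))

    saturated-adjacent : ∀ {i} → Saturated C i → AdjacentToAllExcept (vertex i) (List.map vertex (partners C i))
    saturated-adjacent (inj₁ i∈) = All.lookup closed i∈
    saturated-adjacent {i} (inj₂ two) =
      byTwoPartners (partners C i) (filter⁺ _ (allFin⁺ size)) (All.tabulate partner) two
      where
      byTwoPartners : ∀ js → ListUnique js → All (λ j → i ≢ j × NonEdge C i j) js → 2 ≤ List.length js →
                      AdjacentToAllExcept (vertex i) (List.map vertex js)
      byTwoPartners (j ∷ j' ∷ _) ((j≢j' ∷ _) ∷ _) ((i≢j , ij) ∷ (i≢j' , ij') ∷ _) _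
                    w w≢vi (w≢vj ∷ w≢vj' ∷ _) =
        saturation ((i≢j ∘ vertex! ∷ i≢j' ∘ vertex! ∷ []) ∷ (j≢j' ∘ vertex! ∷ []) ∷ [] ∷ [])
                   (nonEdge⇒nonAdjacent ij) (nonEdge⇒nonAdjacent ij') w w≢vi (w≢vj ∷ w≢vj' ∷ [])
      byTwoPartners (_ ∷ []) _ _ (s≤s ())

    known-sound : ∀ {i j b} → known C i j ≡ just b → G (vertex i) (vertex j) ≡ b
    known-sound {i} {j} {b} = sound (i ≟ j) (nonEdge? C i j) (saturated? C i) (saturated? C j)
      where
      sound : (d₀ : Dec (i ≡ j)) (d₁ : Dec (NonEdge C i j)) (d₂ : Dec (Saturated C i))
              (d₃ : Dec (Saturated C j)) → adjacencyFrom d₀ d₁ d₂ d₃ ≡ just b → G (vertex i) (vertex j) ≡ b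
      sound (yes refl) _         _          _          refl = gloop (vertex i)
      sound (no _)     (yes ij)  _          _          refl = nonEdge⇒nonAdjacent ij
      sound (no i≢j)   (no ¬ij)  (yes sat)  _          refl =
        saturated-adjacent sat (vertex j) (i≢j ∘ sym ∘ vertex!) (outsidePartners ¬ij)
      sound (no i≢j)   (no ¬ij)  (no _)     (yes sat)  refl =
        trans (gsym _ _)
              (saturated-adjacent sat (vertex i) (i≢j ∘ vertex!) (outsidePartners (¬ij ∘ NonEdge-sym {C})))

    component-adjacent : ∀ {Q} → IsClosedComponent C Q → ∀ {u} → VecAll.All (u ≢_) vertices →
                         ∀ i → G (vertex i) u ≡ true
    component-adjacent (saturated , _) u∉ i = saturated-adjacent (saturated i) _ (VecAll.lookup⁺ u∉ i)
      (All.map⁺ (All.tabulate λ {j} _ → VecAll.lookup⁺ u∉ j))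

    component≅ : ∀ {Q} → IsClosedComponent C Q → CompleteOutside vertices → G ≅ (complete (n ∸ size) ⋁ Q)
    component≅ {Q} closedComponent completeOutside =
      joinIsomorphism G graph vertex vertex! Q (λ i j → known-sound (proj₂ closedComponent i j)) universal
      where
      universal : ∀ u → (∀ i → vertex i ≢ u) → ∀ w → w ≢ u → G u w ≡ true
      universal u u∉ w w≢u with any? (λ j → vertex j ≟ w)
      ... | yes (j , refl) =
        trans (gsym u _) (component-adjacent closedComponent (VecAll.lookup⁻ (≢-sym ∘ u∉)) j)
      ... | no w∉          = completeOutside u w (VecAll.lookup⁻ (≢-sym ∘ u∉))
                                             (VecAll.lookup⁻ λ i w≡vᵢ → w∉ (i , sym w≡vᵢ)) (≢-sym w≢u)

  data OtherNonNeighbour (v b : Fin n) : Set where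
    found         : ∀ w → w ≢ v → w ≢ b → G v w ≡ false → OtherNonNeighbour v b
    adjacentToAll : AdjacentToAllExcept v (b ∷ []) → OtherNonNeighbour v b

  otherNonNeighbour : ∀ v b → OtherNonNeighbour v b
  otherNonNeighbour v b with any? (λ w → ¬? (w ≟ v) ×-dec ¬? (w ≟ b) ×-dec G v w Bool.≟ false)
  ... | yes (w , w≢v , w≢b , vw) = found w w≢v w≢b vw
  ... | no none = adjacentToAll adjacent
    where
    adjacent : AdjacentToAllExcept v (b ∷ [])
    adjacent w w≢v (w≢b ∷ []) with G v w in vw
    ... | true  = refl
    ... | false = contradiction (w , w≢v , w≢b , vw) none

  data NonEdgeOutside {k} (S : Vec (Fin n) k) : Set where
    nonEdge : ∀ u w → VecAll.All (u ≢_) S → VecAll.All (w ≢_) S → u ≢ w → G u w ≡ false → NonEdgeOutside S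
    none    : CompleteOutside S → NonEdgeOutside S

  nonEdgeOutside : ∀ {k} (S : Vec (Fin n) k) → NonEdgeOutside S
  nonEdgeOutside S with any? (λ u → any? λ w → VecAll.all? (λ x → ¬? (u ≟ x)) S ×-dec
                                               VecAll.all? (λ x → ¬? (w ≟ x)) S ×-dec
                                               ¬? (u ≟ w) ×-dec G u w Bool.≟ false)
  ... | yes (u , w , u∉ , w∉ , u≢w , uw) = nonEdge u w u∉ w∉ u≢w uw
  ... | no noNonEdge = none adjacent
    where
    adjacent : CompleteOutside S
    adjacent u w u∉ w∉ u≢w with G u w in uw
    ... | true  = refl
    ... | false = contradiction (u , w , u∉ , w∉ , u≢w , uw) noNonEdge

  middle-saturated : ∀ {x m y} → Unique (x ∷ m ∷ y ∷ []) → G x m ≡ false → G m y ≡ false →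
                     AdjacentToAllExcept m (x ∷ y ∷ [])
  middle-saturated ((x≢m ∷ x≢y ∷ []) ∷ (m≢y ∷ []) ∷ [] ∷ []) xm my =
    saturation ((≢-sym x≢m ∷ m≢y ∷ []) ∷ (x≢y ∷ []) ∷ [] ∷ []) (trans (gsym _ _) xm) my

  ≢-byAdjacency : ∀ {v s w} → G v s ≡ true → G v w ≡ false → w ≢ s
  ≢-byAdjacency vs vw refl with trans (sym vs) vw
  ... | ()

  nonNeighbour∉ : ∀ {k} {S : Vec (Fin n) k} {v v'} → VecAll.All (λ s → G s v ≡ true) S → G v v' ≡ false →
                  VecAll.All (v' ≢_) S
  nonNeighbour∉ Sv vv' = VecAll.map (λ sv → ≢-byAdjacency (trans (gsym _ _) sv) vv') Sv

  -- In the complement, an edge uw without neighbours in S lies on a path of three vertices avoiding S,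
  -- or is a component by itself.
  data Extension {k} (S : Vec (Fin n) k) (u w : Fin n) : Set where
    path     : ∀ {x m y} → Unique (S Vec.++ x ∷ m ∷ y ∷ []) → G x m ≡ false → G m y ≡ false → Extension S u w
    isolated : AdjacentToAllExcept u (w ∷ []) → AdjacentToAllExcept w (u ∷ []) → Extension S u w

  extension : ∀ {k} {S : Vec (Fin n) k} {u w} → Unique S → VecAll.All (u ≢_) S → VecAll.All (w ≢_) S →
              u ≢ w → G u w ≡ false → VecAll.All (λ s → G s u ≡ true) S → VecAll.All (λ s → G s w ≡ true) S →
              Extension S u w
  extension {S = S} {u} {w} S! u∉ w∉ u≢w uw Su Sw with otherNonNeighbour u w
  ... | found u' u'≢u u'≢w uu' =
    path (snoc₃-unique S! ((u'≢u ∷ u'≢w ∷ []) ∷ (u≢w ∷ []) ∷ [] ∷ []) (nonNeighbour∉ Su uu') u∉ w∉)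
         (trans (gsym u' u) uu') uw
  ... | adjacentToAll clu with otherNonNeighbour w u
  ...   | found w' w'≢w w'≢u ww' =
    path (snoc₃-unique S! ((u≢w ∷ ≢-sym w'≢u ∷ []) ∷ (≢-sym w'≢w ∷ []) ∷ [] ∷ []) u∉ w∉ (nonNeighbour∉ Sw ww'))
         uw ww'
  ...   | adjacentToAll clw = isolated clu clw

-- The classification

module Classification {n} (G : Adj n) (graph : IsGraph G) (diam : ∀ u v → dist G u v ≤ 2)
  (mindeg : MinDegreeAtLeast G (n ∸ 3)) (7≤n : 7 ≤ n) (etaP : EtaP≡ G (n ∸ 2)) where

  open DenseGraph G graph mindeg

  Classified : Set
  Classified = (G ≅ (complete (n ∸ 3) ⋁ (complete 2 ⊕ complete 1)))
             ⊎ (G ≅ (complete (n ∸ 3) ⋁ edgeless 3))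
             ⊎ (G ≅ (complete (n ∸ 4) ⋁ cycle4))
             ⊎ (G ≅ (complete (n ∸ 4) ⋁ path4))
             ⊎ (G ≅ (complete (n ∸ 4) ⋁ twoK2))

  4≤n : 4 ≤ n
  4≤n = ≤-trans (m≤m+n 4 3) 7≤n

  5<n : 5 < n
  5<n = ≤-trans (m≤m+n 6 1) 7≤n

  noSmallPattern : (P : SmallPattern) → Realisation (SmallPattern.configuration P) → ⊥
  noSmallPattern P R = <⇒≱ fewer (proj₂ etaP _ _ (proj₂ resDomPartition))
    where
    open SmallPattern P
    open PatternPartition G diam (neighbour 4≤n) (vertex R) (vertex! R) (known configuration) (known-sound R)
                          class (toWitness valid)
    fewer : n ∸ Configuration.size configuration + classes < n ∸ 2
    fewer rewrite size≡ = fewerClasses (subst (_≤ n) size≡ (injective⇒≤ (vertex! R)))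

  noPath₅ : ∀ {v₁ v₂ v₃ v₄ v₅} → Unique (v₁ ∷ v₂ ∷ v₃ ∷ v₄ ∷ v₅ ∷ []) →
            G v₁ v₂ ≡ false → G v₂ v₃ ≡ false → G v₃ v₄ ≡ false → G v₄ v₅ ≡ false → ⊥
  noPath₅ {v₁} {v₂} {v₃} {v₄} {v₅} vs! g₁₂ g₂₃ g₃₄ g₄₅ with fresh (v₁ ∷ v₂ ∷ v₃ ∷ v₄ ∷ v₅ ∷ []) 5<n
  ... | z , z∉ = noSmallPattern path₅-pattern record
    { vertices = z ∷ v₁ ∷ v₂ ∷ v₃ ∷ v₄ ∷ v₅ ∷ [] ; distinct = z∉ ∷ vs!
    ; nonAdjacent = g₁₂ ∷ g₂₃ ∷ g₃₄ ∷ g₄₅ ∷ [] ; closed = [] }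

  noEdgeAndPath₃ : ∀ {a b x m y} → Unique (a ∷ b ∷ x ∷ m ∷ y ∷ []) →
                   G a b ≡ false → G x m ≡ false → G m y ≡ false →
                   AdjacentToAllExcept a (b ∷ []) → AdjacentToAllExcept b (a ∷ []) → ⊥
  noEdgeAndPath₃ {a} {b} {x} {m} {y} vs! ab xm my cla clb with fresh (a ∷ b ∷ x ∷ m ∷ y ∷ []) 5<n
  ... | z₁ , z₁∉ with fresh (z₁ ∷ a ∷ b ∷ x ∷ m ∷ y ∷ []) 7≤n
  ...   | z₂ , z₂∉ = noSmallPattern edge-path₃-pattern record
    { vertices = z₂ ∷ z₁ ∷ a ∷ b ∷ x ∷ m ∷ y ∷ [] ; distinct = z₂∉ ∷ z₁∉ ∷ vs!
    ; nonAdjacent = ab ∷ xm ∷ my ∷ [] ; closed = cla ∷ clb ∷ [] }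

  noTwoPaths₃ : ∀ {x m y x' m' y'} → Unique (x ∷ m ∷ y ∷ x' ∷ m' ∷ y' ∷ []) →
                G x m ≡ false → G m y ≡ false → G x' m' ≡ false → G m' y' ≡ false → ⊥
  noTwoPaths₃ {x} {m} {y} {x'} {m'} {y'} vs! xm my x'm' m'y'
    with fresh (x ∷ m ∷ y ∷ x' ∷ m' ∷ y' ∷ []) 7≤n
  ... | z , z∉ = noSmallPattern path₃-path₃-pattern record
    { vertices = z ∷ x ∷ m ∷ y ∷ x' ∷ m' ∷ y' ∷ [] ; distinct = z∉ ∷ vs!
    ; nonAdjacent = xm ∷ my ∷ x'm' ∷ m'y' ∷ [] ; closed = [] }

  noThreeEdges : ∀ {p q a x b y} → Unique (p ∷ q ∷ a ∷ x ∷ b ∷ y ∷ []) →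
                 G p q ≡ false → G a b ≡ false → G x y ≡ false →
                 AdjacentToAllExcept p (q ∷ []) → AdjacentToAllExcept q (p ∷ []) →
                 AdjacentToAllExcept a (b ∷ []) → AdjacentToAllExcept x (y ∷ []) →
                 AdjacentToAllExcept b (a ∷ []) → AdjacentToAllExcept y (x ∷ []) → ⊥
  noThreeEdges {p} {q} {a} {x} {b} {y} vs! pq ab xy clp clq cla clx clb cly
    with fresh (p ∷ q ∷ a ∷ x ∷ b ∷ y ∷ []) 7≤n
  ... | z , z∉ = noSmallPattern three-edges-pattern record
    { vertices = z ∷ p ∷ q ∷ a ∷ x ∷ b ∷ y ∷ [] ; distinct = z∉ ∷ vs!
    ; nonAdjacent = pq ∷ ab ∷ xy ∷ [] ; closed = clp ∷ clq ∷ cla ∷ clx ∷ clb ∷ cly ∷ [] }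

  -- If a and b are the only vertices that are not adjacent to all others, some vertex other than a
  -- (resp. b) shares its class; then a and its classmate have the same distances to all classes.
  module IsolatedNonEdge {a b} (cla : AdjacentToAllExcept a (b ∷ [])) (clb : AdjacentToAllExcept b (a ∷ []))
    (completeOutside : CompleteOutside (a ∷ b ∷ []))
    where

    c : Fin n → Fin (n ∸ 2)
    c = proj₁ (proj₁ etaP)

    member : ∀ J → ∃ λ w → c w ≡ J
    member = proj₁ (proj₂ (proj₁ etaP))

    resolving : IsResolving G c
    resolving = proj₁ (proj₂ (proj₂ (proj₁ etaP)))

    Universal : Fin n → Set
    Universal u = ∀ w → w ≢ u → G u w ≡ true

    universal : ∀ {u} → u ≢ a → u ≢ b → Universal u
    universal {u} u≢a u≢b w w≢u with w ≟ a | w ≟ b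
    ... | yes refl | _        = trans (gsym u a) (cla u u≢a (u≢b ∷ []))
    ... | no _     | yes refl = trans (gsym u b) (clb u u≢b (u≢a ∷ []))
    ... | no w≢a   | no w≢b   = completeOutside u w (u≢a ∷ u≢b ∷ []) (w≢a ∷ w≢b ∷ []) (≢-sym w≢u)

    universal-setDist : ∀ {u J} → Universal u → c u ≢ J → setDist G c u J ≡ 1
    universal-setDist {u} {J} univ cu≢J with member J
    ... | w , cw = setDist-adjacent G c cu≢J cw (univ w λ w≡u → cu≢J (trans (cong c (sym w≡u)) cw))

    twins : ∀ {u w} → Universal u → Universal w → c u ≡ c w → u ≡ w
    twins {u} {w} univu univw cu≡cw = resolving u w λ J → byClass J (c u ≟ J)
      where
      byClass : ∀ J → Dec (c u ≡ J) → setDist G c u J ≡ setDist G c w J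
      byClass J (yes cu≡J) = trans (setDist-own G c cu≡J) (sym (setDist-own G c (trans (sym cu≡cw) cu≡J)))
      byClass J (no cu≢J)  =
        trans (universal-setDist univu cu≢J) (sym (universal-setDist univw (cu≢J ∘ trans cu≡cw)))

    suc[n∸2]<n : suc (n ∸ 2) < n
    suc[n∸2]<n = subst (_≤ n) (+-comm (n ∸ 2) 2) (≤-reflexive (m∸n+n≡m (≤-trans (m≤m+n 2 5) 7≤n)))

    classmate : ∀ {x y} → (∀ {u} → u ≢ x → u ≢ y → Universal u) → ∃ λ x' → x' ≢ x × x' ≢ y × c x' ≡ c x
    classmate {x} {y} univ with pigeonholeAvoiding suc[n∸2]<n c y
    ... | u , w , u≢w , u≢y , w≢y , cu≡cw with u ≟ x | w ≟ x
    ...   | yes refl | _        = w , ≢-sym u≢w , w≢y , sym cu≡cw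
    ...   | no _     | yes refl = u , u≢w , u≢y , cu≡cw
    ...   | no u≢x   | no w≢x   = contradiction (twins (univ u≢x u≢y) (univ w≢x w≢y) cu≡cw) u≢w

    impossible : ⊥
    impossible with classmate universal | classmate {b} {a} (λ u≢b u≢a → universal u≢a u≢b)
    ... | a' , a'≢a , a'≢b , ca'≡ca | b' , b'≢b , b'≢a , cb'≡cb = a'≢a (sym (resolving a a' sameDistances))
      where
      sameDistances : ∀ J → setDist G c a J ≡ setDist G c a' J
      sameDistances J with c a ≟ J
      ... | yes ca≡J = trans (setDist-own G c ca≡J) (sym (setDist-own G c (trans ca'≡ca ca≡J)))
      ... | no ca≢J  = trans (aDist (c b ≟ J))
                             (sym (universal-setDist (universal a'≢a a'≢b) (ca≢J ∘ trans (sym ca'≡ca))))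
        where
        aDist : Dec (c b ≡ J) → setDist G c a J ≡ 1
        aDist (yes cb≡J) = setDist-adjacent G c ca≢J (trans cb'≡cb cb≡J) (cla b' b'≢a (b'≢b ∷ []))
        aDist (no cb≢J) with member J
        ... | w , cw = setDist-adjacent G c ca≢J cw (cla w (λ w≡a → ca≢J (trans (cong c (sym w≡a)) cw))
                                                         ((λ w≡b → cb≢J (trans (cong c (sym w≡b)) cw)) ∷ []))

  noSecondNonEdge : ∀ {x m y u w} → Unique (x ∷ m ∷ y ∷ []) → G x m ≡ false → G m y ≡ false →
                    VecAll.All (u ≢_) (x ∷ m ∷ y ∷ []) → VecAll.All (w ≢_) (x ∷ m ∷ y ∷ []) →
                    u ≢ w → G u w ≡ false →
                    VecAll.All (λ s → G s u ≡ true) (x ∷ m ∷ y ∷ []) →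
                    VecAll.All (λ s → G s w ≡ true) (x ∷ m ∷ y ∷ []) → ⊥
  noSecondNonEdge xmy! xm my u∉ w∉ u≢w uw Su Sw with extension xmy! u∉ w∉ u≢w uw Su Sw
  ... | path vs! x'm' m'y' = noTwoPaths₃ vs! xm my x'm' m'y'
  ... | isolated clu clw   = noEdgeAndPath₃ ((u≢w ∷ u∉) ∷ w∉ ∷ xmy!) uw xm my clu clw

  classifyComponent : ∀ {C Q} (R : Realisation C) → IsClosedComponent C Q →
    (G ≅ (complete (n ∸ Configuration.size C) ⋁ Q) → Classified) →
    (∀ {u w} → VecAll.All (u ≢_) (Realisation.vertices R) → VecAll.All (w ≢_) (Realisation.vertices R) →
               u ≢ w → G u w ≡ false → ⊥) →
    Classified
  classifyComponent R closedComponent classified noNonEdge with nonEdgeOutside (Realisation.vertices R)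
  ... | none completeOutside       = classified (component≅ R closedComponent completeOutside)
  ... | nonEdge u w u∉ w∉ u≢w uw = ⊥-elim (noNonEdge u∉ w∉ u≢w uw)

  closedTriangle : ∀ {x m y} → Unique (x ∷ m ∷ y ∷ []) →
                   G x m ≡ false → G m y ≡ false → G x y ≡ false → Classified
  closedTriangle {x} {m} {y} xmy! xm my xy =
    classifyComponent R triangle-closed (inj₂ ∘ inj₁) λ u∉ w∉ u≢w uw →
      noSecondNonEdge xmy! xm my u∉ w∉ u≢w uw (adjacent u∉) (adjacent w∉)
    where
    R : Realisation triangle-component
    R = record { vertices = x ∷ m ∷ y ∷ [] ; distinct = xmy! ; nonAdjacent = xm ∷ my ∷ xy ∷ [] ; closed = [] }
    adjacent : ∀ {u} → VecAll.All (u ≢_) (x ∷ m ∷ y ∷ []) → VecAll.All (λ s → G s u ≡ true) (x ∷ m ∷ y ∷ [])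
    adjacent u∉ = VecAll.lookup⁻ (component-adjacent R triangle-closed u∉)

  closedPath₃ : ∀ {x m y} → Unique (x ∷ m ∷ y ∷ []) → G x m ≡ false → G m y ≡ false →
                AdjacentToAllExcept x (m ∷ []) → AdjacentToAllExcept y (m ∷ []) → Classified
  closedPath₃ {x} {m} {y} xmy!@((x≢m ∷ x≢y ∷ []) ∷ (m≢y ∷ []) ∷ [] ∷ []) xm my clx cly =
    classifyComponent R path₃-closed inj₁ λ where
      u∉@(u≢x ∷ u≢y ∷ u≢m ∷ []) w∉@(w≢x ∷ w≢y ∷ w≢m ∷ []) u≢w uw →
        noSecondNonEdge xmy! xm my (u≢x ∷ u≢m ∷ u≢y ∷ []) (w≢x ∷ w≢m ∷ w≢y ∷ []) u≢w uw
                        (onPath u∉) (onPath w∉)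
    where
    R : Realisation path₃-component
    R = record { vertices = x ∷ y ∷ m ∷ [] ; distinct = (x≢y ∷ x≢m ∷ []) ∷ (≢-sym m≢y ∷ []) ∷ [] ∷ []
               ; nonAdjacent = xm ∷ trans (gsym y m) my ∷ [] ; closed = clx ∷ cly ∷ [] }
    onPath : ∀ {u} → VecAll.All (u ≢_) (x ∷ y ∷ m ∷ []) → VecAll.All (λ s → G s u ≡ true) (x ∷ m ∷ y ∷ [])
    onPath u∉ = adjacent 0F ∷ adjacent 2F ∷ adjacent 1F ∷ []
      where adjacent = component-adjacent R path₃-closed u∉

  closedPath₄ : ∀ {v₁ v₂ v₃ v₄} → Unique (v₁ ∷ v₂ ∷ v₃ ∷ v₄ ∷ []) →
                G v₁ v₂ ≡ false → G v₂ v₃ ≡ false → G v₃ v₄ ≡ false →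
                AdjacentToAllExcept v₁ (v₂ ∷ []) → AdjacentToAllExcept v₄ (v₃ ∷ []) → Classified
  closedPath₄ {v₁} {v₂} {v₃} {v₄} ((d₁₂ ∷ d₁₃ ∷ d₁₄ ∷ []) ∷ (d₂₃ ∷ d₂₄ ∷ []) ∷ (d₃₄ ∷ []) ∷ [] ∷ [])
              g₁₂ g₂₃ g₃₄ cl₁ cl₄ =
    classifyComponent R path₄-closed (inj₂ ∘ inj₂ ∘ inj₂ ∘ inj₁) λ where
      u∉@(u≢v₂ ∷ u≢v₄ ∷ u≢v₁ ∷ u≢v₃ ∷ []) w∉@(w≢v₂ ∷ w≢v₄ ∷ w≢v₁ ∷ w≢v₃ ∷ []) u≢w uw →
        noSecondNonEdge ((d₁₂ ∷ d₁₃ ∷ []) ∷ (d₂₃ ∷ []) ∷ [] ∷ []) g₁₂ g₂₃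
          (u≢v₁ ∷ u≢v₂ ∷ u≢v₃ ∷ []) (w≢v₁ ∷ w≢v₂ ∷ w≢v₃ ∷ []) u≢w uw (onPath u∉) (onPath w∉)
    where
    R : Realisation path₄-component
    R = record { vertices = v₂ ∷ v₄ ∷ v₁ ∷ v₃ ∷ []
               ; distinct = (d₂₄ ∷ ≢-sym d₁₂ ∷ d₂₃ ∷ []) ∷ (≢-sym d₁₄ ∷ ≢-sym d₃₄ ∷ []) ∷ (d₁₃ ∷ []) ∷ [] ∷ []
               ; nonAdjacent = g₁₂ ∷ g₂₃ ∷ g₃₄ ∷ [] ; closed = cl₄ ∷ cl₁ ∷ [] }
    onPath : ∀ {u} → VecAll.All (u ≢_) (v₂ ∷ v₄ ∷ v₁ ∷ v₃ ∷ []) →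
             VecAll.All (λ s → G s u ≡ true) (v₁ ∷ v₂ ∷ v₃ ∷ [])
    onPath u∉ = adjacent 2F ∷ adjacent 0F ∷ adjacent 3F ∷ []
      where adjacent = component-adjacent R path₄-closed u∉

  closedCycle₄ : ∀ {v₁ v₂ v₃ v₄} → Unique (v₁ ∷ v₂ ∷ v₃ ∷ v₄ ∷ []) →
                 G v₁ v₂ ≡ false → G v₂ v₃ ≡ false → G v₃ v₄ ≡ false → G v₁ v₄ ≡ false → Classified
  closedCycle₄ {v₁} {v₂} {v₃} {v₄} ((d₁₂ ∷ d₁₃ ∷ d₁₄ ∷ []) ∷ (d₂₃ ∷ d₂₄ ∷ []) ∷ (d₃₄ ∷ []) ∷ [] ∷ [])
               g₁₂ g₂₃ g₃₄ g₁₄ =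
    classifyComponent R cycle₄-closed (inj₂ ∘ inj₂ ∘ inj₂ ∘ inj₂) λ where
      u∉@(u≢v₁ ∷ u≢v₃ ∷ u≢v₂ ∷ u≢v₄ ∷ []) w∉@(w≢v₁ ∷ w≢v₃ ∷ w≢v₂ ∷ w≢v₄ ∷ []) u≢w uw →
        noSecondNonEdge ((d₁₂ ∷ d₁₃ ∷ []) ∷ (d₂₃ ∷ []) ∷ [] ∷ []) g₁₂ g₂₃
          (u≢v₁ ∷ u≢v₂ ∷ u≢v₃ ∷ []) (w≢v₁ ∷ w≢v₂ ∷ w≢v₃ ∷ []) u≢w uw (onPath u∉) (onPath w∉)
    where
    R : Realisation cycle₄-component
    R = record { vertices = v₁ ∷ v₃ ∷ v₂ ∷ v₄ ∷ []
               ; distinct = (d₁₃ ∷ d₁₂ ∷ d₁₄ ∷ []) ∷ (≢-sym d₂₃ ∷ d₃₄ ∷ []) ∷ (d₂₄ ∷ []) ∷ [] ∷ []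
               ; nonAdjacent = g₁₂ ∷ g₂₃ ∷ g₃₄ ∷ trans (gsym v₄ v₁) g₁₄ ∷ [] ; closed = [] }
    onPath : ∀ {u} → VecAll.All (u ≢_) (v₁ ∷ v₃ ∷ v₂ ∷ v₄ ∷ []) →
             VecAll.All (λ s → G s u ≡ true) (v₁ ∷ v₂ ∷ v₃ ∷ [])
    onPath u∉ = adjacent 0F ∷ adjacent 2F ∷ adjacent 1F ∷ []
      where adjacent = component-adjacent R cycle₄-closed u∉

  noThirdNonEdge : ∀ {a x b y p q} → Unique (a ∷ x ∷ b ∷ y ∷ []) → G a b ≡ false → G x y ≡ false →
                   AdjacentToAllExcept a (b ∷ []) → AdjacentToAllExcept x (y ∷ []) →
                   AdjacentToAllExcept b (a ∷ []) → AdjacentToAllExcept y (x ∷ []) →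
                   VecAll.All (p ≢_) (a ∷ x ∷ b ∷ y ∷ []) → VecAll.All (q ≢_) (a ∷ x ∷ b ∷ y ∷ []) →
                   p ≢ q → G p q ≡ false → ⊥
  noThirdNonEdge {a} {x} {b} {y} {p} {q} axby!@((_ ∷ a≢b ∷ _ ∷ []) ∷ _) ab xy cla clx clb cly
                 p∉@(p≢a ∷ _ ∷ p≢b ∷ _ ∷ []) q∉@(q≢a ∷ _ ∷ q≢b ∷ _ ∷ []) p≢q pq
    with extension ((a≢b ∷ []) ∷ [] ∷ []) (p≢a ∷ p≢b ∷ []) (q≢a ∷ q≢b ∷ []) p≢q pq
                   (cla p p≢a (p≢b ∷ []) ∷ clb p p≢b (p≢a ∷ []) ∷ [])
                   (cla q q≢a (q≢b ∷ []) ∷ clb q q≢b (q≢a ∷ []) ∷ [])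
  ... | path vs! p'p pq'   = noEdgeAndPath₃ vs! ab p'p pq' cla clb
  ... | isolated clp clq = noThreeEdges ((p≢q ∷ p∉) ∷ q∉ ∷ axby!) pq ab xy clp clq cla clx clb cly

  closedTwoEdges : ∀ {a x b y} → Unique (a ∷ x ∷ b ∷ y ∷ []) → G a b ≡ false → G x y ≡ false →
                   AdjacentToAllExcept a (b ∷ []) → AdjacentToAllExcept x (y ∷ []) →
                   AdjacentToAllExcept b (a ∷ []) → AdjacentToAllExcept y (x ∷ []) → Classified
  closedTwoEdges {a} {x} {b} {y} axby! ab xy cla clx clb cly =
    classifyComponent R two-edges-closed (inj₂ ∘ inj₂ ∘ inj₁) (noThirdNonEdge axby! ab xy cla clx clb cly)
    where
    R : Realisation two-edges-component
    R = record { vertices = a ∷ x ∷ b ∷ y ∷ [] ; distinct = axby!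
               ; nonAdjacent = ab ∷ xy ∷ [] ; closed = cla ∷ clx ∷ clb ∷ cly ∷ [] }

  fromIsolatedNonEdge : ∀ {a b} → a ≢ b → G a b ≡ false →
                        AdjacentToAllExcept a (b ∷ []) → AdjacentToAllExcept b (a ∷ []) → Classified
  fromIsolatedNonEdge {a} {b} a≢b ab cla clb with nonEdgeOutside (a ∷ b ∷ [])
  ... | none completeOutside = ⊥-elim (IsolatedNonEdge.impossible cla clb completeOutside)
  ... | nonEdge x y x∉@(x≢a ∷ x≢b ∷ []) y∉@(y≢a ∷ y≢b ∷ []) x≢y xy
    with extension ((a≢b ∷ []) ∷ [] ∷ []) x∉ y∉ x≢y xy
                   (cla x x≢a (x≢b ∷ []) ∷ clb x x≢b (x≢a ∷ []) ∷ [])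
                   (cla y y≢a (y≢b ∷ []) ∷ clb y y≢b (y≢a ∷ []) ∷ [])
  ...   | path vs! x'x xy'     = ⊥-elim (noEdgeAndPath₃ vs! ab x'x xy' cla clb)
  ...   | isolated clx cly =
    closedTwoEdges ((≢-sym x≢a ∷ a≢b ∷ ≢-sym y≢a ∷ []) ∷ (x≢b ∷ x≢y ∷ []) ∷ (≢-sym y≢b ∷ []) ∷ [] ∷ [])
                   ab xy cla clx clb cly

  fromPath₄ : ∀ {v₁ v₂ v₃ v₄} → Unique (v₁ ∷ v₂ ∷ v₃ ∷ v₄ ∷ []) →
              G v₁ v₂ ≡ false → G v₂ v₃ ≡ false → G v₃ v₄ ≡ false → Classified
  fromPath₄ {v₁} {v₂} {v₃} {v₄} vs!@((d₁₂ ∷ d₁₃ ∷ d₁₄ ∷ []) ∷ (d₂₃ ∷ d₂₄ ∷ []) ∷ (d₃₄ ∷ []) ∷ [] ∷ [])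
            g₁₂ g₂₃ g₃₄ with otherNonNeighbour v₄ v₃
  ... | found w w≢v₄ w≢v₃ v₄w with w ≟ v₁
  ...   | yes refl = closedCycle₄ vs! g₁₂ g₂₃ g₃₄ (trans (gsym w v₄) v₄w)
  ...   | no w≢v₁  = ⊥-elim (noPath₅ path! g₁₂ g₂₃ g₃₄ v₄w)
    where
    w≢v₂ : w ≢ v₂
    w≢v₂ = ≢-byAdjacency (trans (gsym v₄ v₂) (middle-saturated ((d₁₂ ∷ d₁₃ ∷ []) ∷ (d₂₃ ∷ []) ∷ [] ∷ []) g₁₂ g₂₃
                                                 v₄ (≢-sym d₂₄) (≢-sym d₁₄ ∷ ≢-sym d₃₄ ∷ []))) v₄w
    path! : Unique (v₁ ∷ v₂ ∷ v₃ ∷ v₄ ∷ w ∷ [])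
    path! = (d₁₂ ∷ d₁₃ ∷ d₁₄ ∷ ≢-sym w≢v₁ ∷ []) ∷ (d₂₃ ∷ d₂₄ ∷ ≢-sym w≢v₂ ∷ []) ∷
            (d₃₄ ∷ ≢-sym w≢v₃ ∷ []) ∷ (≢-sym w≢v₄ ∷ []) ∷ [] ∷ []
  fromPath₄ {v₁} {v₂} {v₃} {v₄} vs!@((d₁₂ ∷ d₁₃ ∷ d₁₄ ∷ []) ∷ (d₂₃ ∷ d₂₄ ∷ []) ∷ (d₃₄ ∷ []) ∷ [] ∷ [])
            g₁₂ g₂₃ g₃₄ | adjacentToAll cl₄ with otherNonNeighbour v₁ v₂
  ... | found w w≢v₁ w≢v₂ v₁w =
    ⊥-elim (noPath₅ ((w≢v₁ ∷ w≢v₂ ∷ w≢v₃ ∷ w≢v₄ ∷ []) ∷ vs!) (trans (gsym w v₁) v₁w) g₁₂ g₂₃ g₃₄)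
    where
    w≢v₃ : w ≢ v₃
    w≢v₃ = ≢-byAdjacency (trans (gsym v₁ v₃) (middle-saturated ((d₂₃ ∷ d₂₄ ∷ []) ∷ (d₃₄ ∷ []) ∷ [] ∷ []) g₂₃ g₃₄
                                                 v₁ d₁₃ (d₁₂ ∷ d₁₄ ∷ []))) v₁w
    w≢v₄ : w ≢ v₄
    w≢v₄ = ≢-byAdjacency (trans (gsym v₁ v₄) (cl₄ v₁ d₁₄ (d₁₃ ∷ []))) v₁w
  ... | adjacentToAll cl₁ = closedPath₄ vs! g₁₂ g₂₃ g₃₄ cl₁ cl₄

  fromPath₃ : ∀ {x m y} → Unique (x ∷ m ∷ y ∷ []) → G x m ≡ false → G m y ≡ false → Classified
  fromPath₃ {x} {m} {y} xmy!@((x≢m ∷ x≢y ∷ []) ∷ (m≢y ∷ []) ∷ [] ∷ []) xm my with otherNonNeighbour y m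
  ... | found w w≢y w≢m yw with w ≟ x
  ...   | yes refl = closedTriangle xmy! xm my (trans (gsym w y) yw)
  ...   | no w≢x   =
    fromPath₄ ((x≢m ∷ x≢y ∷ ≢-sym w≢x ∷ []) ∷ (m≢y ∷ ≢-sym w≢m ∷ []) ∷ (≢-sym w≢y ∷ []) ∷ [] ∷ []) xm my yw
  fromPath₃ {x} {m} {y} xmy!@((x≢m ∷ x≢y ∷ []) ∷ (m≢y ∷ []) ∷ [] ∷ []) xm my | adjacentToAll cly
    with otherNonNeighbour x m
  ... | found w w≢x w≢m xw = fromPath₄ ((w≢x ∷ w≢m ∷ w≢y ∷ []) ∷ xmy!) (trans (gsym w x) xw) xm my
    where
    w≢y : w ≢ y
    w≢y = ≢-byAdjacency (trans (gsym x y) (cly x x≢y (x≢m ∷ []))) xw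
  ... | adjacentToAll clx = closedPath₃ xmy! xm my clx cly

  fromNonEdge : ∀ {a b} → a ≢ b → G a b ≡ false → Classified
  fromNonEdge {a} {b} a≢b ab with otherNonNeighbour a b
  ... | found w w≢a w≢b aw = fromPath₃ ((w≢a ∷ w≢b ∷ []) ∷ (a≢b ∷ []) ∷ [] ∷ []) (trans (gsym w a) aw) ab
  ... | adjacentToAll cla with otherNonNeighbour b a
  ...   | found w w≢b w≢a bw = fromPath₃ ((a≢b ∷ ≢-sym w≢a ∷ []) ∷ (≢-sym w≢b ∷ []) ∷ [] ∷ []) ab bw
  ...   | adjacentToAll clb   = fromIsolatedNonEdge a≢b ab cla clb

-- Connectedness is implied by diameter 2 and not used.
mainTheorem14 : (n : ℕ) (G : Adj n) → 7 ≤ n → IsGraph G → Connected G → HasDiameter G 2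
    → MinDegreeAtLeast G (n ∸ 3) → EtaP≡ G (n ∸ 2)
    → (G ≅ (complete (n ∸ 3) ⋁ (complete 2 ⊕ complete 1)))
      ⊎ (G ≅ (complete (n ∸ 3) ⋁ edgeless 3))
      ⊎ (G ≅ (complete (n ∸ 4) ⋁ cycle4))
      ⊎ (G ≅ (complete (n ∸ 4) ⋁ path4))
      ⊎ (G ≅ (complete (n ∸ 4) ⋁ twoK2))
mainTheorem14 n G 7≤n graph _ (diam , a , b , dist≡2) mindeg etaP = fromNonEdge a≢b ab
  where
  open Classification G graph diam mindeg 7≤n etaP
  a≢b : a ≢ b
  a≢b refl = contradiction (trans (sym (dist-refl G a)) dist≡2) λ ()
  ab : G a b ≡ false
  ab = ¬-not λ ab≡true → contradiction (trans (sym (dist-adjacent G a≢b ab≡true)) dist≡2) λ ()
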